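{- Let $X$ be a finite non-empty set and $P\in\mathfrak{P}(X)$ have an FPP-graph. Then every upper cover of $P$ in $(\mathfrak{P}(X),\sqsubseteq)$ has an FPP-graph if and only if $\ell\leq_P u$ for all $(\ell,u)\in L(P)\times U(P)$.
   Context: $\mathfrak{P}(X)$ is the set of all posets with carrier $X$, ordered by $P\sqsubseteq Q$ iff $\leq_P\subseteq\leq_Q$. For a poset $P$: $[x,y]_P=\{z: x\leq_P z\leq_P y\}$; $L(P)$, $U(P)$ are the sets of minimal and maximal elements, $M(P)=X\setminus(L(P)\cup U(P))$; $\prec_P=\{(a,b)\in<_P: M(P)\cap[a,b]_P=\emptyset\}$. $P\setminus(a,b)=(X,\leq_P\setminus\{(a,b)\})$. $P$ is connected iff its comparability graph is connected. $P$ has an FPP-graph iff $P$ is connected and $P\setminus(a,b)$ is disconnected for every $(a,b)\in\prec_P$. -}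

module Defs where

open import Data.Nat using (ℕ)
open import Data.Fin using (Fin)
open import Data.Bool using (Bool; T)
open import Data.Product using (Σ; ∃; ∃-syntax; _×_)
open import Data.Sum using (_⊎_)
open import Relation.Nullary using (¬_)
open import Relation.Binary.PropositionalEquality using (_≡_; _≢_)
open import Function.Bundles using (_⇔_)

-- The finite carrier X is modelled as Fin n.
-- A binary relation on X, given by its (decidable) characteristic function.
BRel : ℕ → Set
BRel n = Fin n → Fin n → Bool

record IsPartialOrderOn {n : ℕ} (R : BRel n) : Set where
  field
    refl′  : ∀ x → T (R x x)
    antisym : ∀ x y → T (R x y) → T (R y x) → x ≡ y
    trans′ : ∀ x y z → T (R x y) → T (R y z) → T (R x z)

record Pos (n : ℕ) : Set where
  field
    rel     : BRel n
    isPO    : IsPartialOrderOn rel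
open Pos public

_≤⟨_⟩_ : ∀ {n} → Fin n → Pos n → Fin n → Set
x ≤⟨ P ⟩ y = T (rel P x y)

_<⟨_⟩_ : ∀ {n} → Fin n → Pos n → Fin n → Set
x <⟨ P ⟩ y = x ≤⟨ P ⟩ y × x ≢ y

_⊑_ : ∀ {n} → Pos n → Pos n → Set
P ⊑ Q = ∀ x y → x ≤⟨ P ⟩ y → x ≤⟨ Q ⟩ y

_⊏_ : ∀ {n} → Pos n → Pos n → Set
P ⊏ Q = P ⊑ Q × ∃[ x ] ∃[ y ] (x ≤⟨ Q ⟩ y × ¬ (x ≤⟨ P ⟩ y))

UpperCover : ∀ {n} → Pos n → Pos n → Set₀
UpperCover {n} P Q = P ⊏ Q × (∀ (R : Pos n) → ¬ (P ⊏ R × R ⊏ Q))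

Minimal : ∀ {n} → Pos n → Fin n → Set
Minimal P x = ∀ y → y ≤⟨ P ⟩ x → y ≡ x

Maximal : ∀ {n} → Pos n → Fin n → Set
Maximal P x = ∀ y → x ≤⟨ P ⟩ y → y ≡ x

Middle : ∀ {n} → Pos n → Fin n → Set
Middle P x = ¬ (Minimal P x ⊎ Maximal P x)

_≺⟨_⟩_ : ∀ {n} → Fin n → Pos n → Fin n → Set
a ≺⟨ P ⟩ b = a <⟨ P ⟩ b × (∀ z → a ≤⟨ P ⟩ z → z ≤⟨ P ⟩ b → ¬ Middle P z)

Comparable : ∀ {n} → (Fin n → Fin n → Set) → Fin n → Fin n → Set
Comparable R x y = R x y ⊎ R y x

data Reach {n} (R : Fin n → Fin n → Set) : Fin n → Fin n → Set where
  here : ∀ {x} → Reach R x x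
  step : ∀ {x y z} → Comparable R x y → Reach R y z → Reach R x z

Connected : ∀ {n} → (Fin n → Fin n → Set) → Set
Connected R = ∀ x y → Reach R x y

≤rel : ∀ {n} → Pos n → Fin n → Fin n → Set
≤rel P x y = x ≤⟨ P ⟩ y

remove : ∀ {n} → Pos n → Fin n → Fin n → Fin n → Fin n → Set
remove P a b x y = x ≤⟨ P ⟩ y × ¬ (x ≡ a × y ≡ b)

HasFPPGraph : ∀ {n} → Pos n → Set
HasFPPGraph P = Connected (≤rel P) × (∀ a b → a ≺⟨ P ⟩ b → ¬ Connected (remove P a b))

-- If every minimal element of P lies below every maximal one, any extension Q ⊒ P
-- keeps the FPP-graph: for a ≺_Q b the pair a, b is minimal/maximal in Q, hence in P,
-- so a ≺_P b; and if Q ∖ (a,b) were connected, a neighbour of b and a neighbour of a in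
-- it yield a minimal m and a maximal M of Q, distinct from a and b because [a,b]_Q = {a,b},
-- giving the detour a ≤ M ≥ m ≤ b in P ∖ (a,b), which would make P ∖ (a,b) connected.
-- Conversely, if l ≰_P u for a minimal l and a maximal u, adding the single pair (l,u)
-- is an upper cover in which l ≺ u, while the cover minus (l,u) still contains P.
module Submission where

open import Defs
open import Data.Nat using (ℕ; suc)
open import Data.Fin using (Fin; _≟_)
open import Data.Bool using (T; _∨_; _∧_)
open import Data.Bool.Properties using (T-∨; T-∧)
open import Data.Empty using (⊥-elim)
open import Data.List using (List; []; _∷_; allFin)
open import Data.List.Membership.Propositional using (_∈_)
open import Data.List.Membership.Propositional.Properties using (∈-allFin)
open import Data.List.Relation.Unary.Any using (here; there)
open import Data.Product using (∃-syntax; _×_; _,_; proj₁; proj₂)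
open import Data.Sum using (_⊎_; inj₁; inj₂; [_,_])
open import Function using (flip; _∘_)
open import Function.Bundles using (_⇔_; mk⇔; Equivalence)
open import Relation.Nullary using (¬_; yes; no)
open import Relation.Nullary.Decidable using (isYes; T?; toWitness; fromWitness)
open import Relation.Binary.PropositionalEquality using (_≡_; _≢_; refl; sym; trans; subst)

open IsPartialOrderOn using (refl′; antisym; trans′)
open Equivalence using (to; from)

MinimaBelowMaxima : ∀ {k} → Pos k → Set
MinimaBelowMaxima P = ∀ l u → Minimal P l → Maximal P u → l ≤⟨ P ⟩ u

-- Definitionally, Maximal P x = Minimal (dual P) x.
dual : ∀ {k} → Pos k → Pos k
dual P = record
  { rel  = flip (rel P)
  ; isPO = record
    { refl′   = refl′ (isPO P)
    ; antisym = λ x y p q → antisym (isPO P) x y q p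
    ; trans′  = λ x y z p q → trans′ (isPO P) z y x q p
    }
  }

module _ {k : ℕ} (P : Pos k) where

  minimal-below-in : ∀ (xs : List (Fin k)) z →
    ∃[ m ] (m ≤⟨ P ⟩ z × (∀ y → y ∈ xs → y ≤⟨ P ⟩ m → y ≡ m))
  minimal-below-in [] z = z , refl′ (isPO P) z , λ _ ()
  minimal-below-in (x ∷ xs) z with T? (rel P x z)
  ... | yes x≤z =
    let m , m≤x , min-m = minimal-below-in xs x in
    m , trans′ (isPO P) m x z m≤x x≤z ,
    λ { y (here refl) y≤m → antisym (isPO P) y m y≤m m≤x
      ; y (there y∈xs) → min-m y y∈xs }
  ... | no x≰z =
    let m , m≤z , min-m = minimal-below-in xs z in
    m , m≤z ,
    λ { y (here refl) y≤m → ⊥-elim (x≰z (trans′ (isPO P) y m z y≤m m≤z))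
      ; y (there y∈xs) → min-m y y∈xs }

  minimal-below : ∀ z → ∃[ m ] (m ≤⟨ P ⟩ z × Minimal P m)
  minimal-below z =
    let m , m≤z , min-m = minimal-below-in (allFin k) z in
    m , m≤z , λ y → min-m y (∈-allFin y)

maximal-above : ∀ {k} (P : Pos k) z → ∃[ M ] (z ≤⟨ P ⟩ M × Maximal P M)
maximal-above P = minimal-below (dual P)

module _ {k : ℕ} {R : Fin k → Fin k → Set} where

  Reach-mono : ∀ {S : Fin k → Fin k → Set} → (∀ x y → R x y → S x y) →
               ∀ {x y} → Reach R x y → Reach S x y
  Reach-mono R⊆S here = here
  Reach-mono R⊆S (step (inj₁ r) p) = step (inj₁ (R⊆S _ _ r)) (Reach-mono R⊆S p)
  Reach-mono R⊆S (step (inj₂ r) p) = step (inj₂ (R⊆S _ _ r)) (Reach-mono R⊆S p)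

  Reach-trans : ∀ {x y z} → Reach R x y → Reach R y z → Reach R x z
  Reach-trans here q = q
  Reach-trans (step c p) q = step c (Reach-trans p q)

  Reach-sym : ∀ {x y} → Reach R x y → Reach R y x
  Reach-sym here = here
  Reach-sym (step c p) = Reach-trans (Reach-sym p) (step ([ inj₂ , inj₁ ] c) here)

  Reach-leave : ∀ {x y} → Reach R x y → x ≢ y → ∃[ z ] (z ≢ x × Comparable R x z)
  Reach-leave here x≢x = ⊥-elim (x≢x refl)
  Reach-leave {x} (step {y = z} c p) x≢y with z ≟ x
  ... | yes refl = Reach-leave p x≢y
  ... | no z≢x = z , z≢x , c

-- Every edge of P other than (a,b) survives in P ∖ (a,b), so a detour from a to b suffices.
remove-connected : ∀ {k} (P : Pos k) {a b} → Connected (≤rel P) →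
  Reach (remove P a b) a b → Connected (remove P a b)
remove-connected P {a} {b} conn detour x y = along (conn x y)
  where
  edge : ∀ x y → x ≤⟨ P ⟩ y → Reach (remove P a b) x y
  edge x y x≤y with x ≟ a | y ≟ b
  ... | yes refl | yes refl = detour
  ... | no x≢a | _ = step (inj₁ (x≤y , x≢a ∘ proj₁)) here
  ... | yes _ | no y≢b = step (inj₁ (x≤y , y≢b ∘ proj₂)) here

  along : ∀ {x y} → Reach (≤rel P) x y → Reach (remove P a b) x y
  along here = here
  along (step (inj₁ x≤z) p) = Reach-trans (edge _ _ x≤z) (along p)
  along (step (inj₂ z≤x) p) = Reach-trans (Reach-sym (edge _ _ z≤x)) (along p)

module _ {k : ℕ} (Q : Pos k) {a b : Fin k} (a≺b : a ≺⟨ Q ⟩ b) where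

  private
    a≤b : a ≤⟨ Q ⟩ b
    a≤b = proj₁ (proj₁ a≺b)

    a≢b : a ≢ b
    a≢b = proj₂ (proj₁ a≺b)

    no-middle : ∀ z → a ≤⟨ Q ⟩ z → z ≤⟨ Q ⟩ b → ¬ Middle Q z
    no-middle = proj₂ a≺b

  ≺-interval : ∀ {z} → a ≤⟨ Q ⟩ z → z ≤⟨ Q ⟩ b → z ≡ a ⊎ z ≡ b
  ≺-interval {z} a≤z z≤b with z ≟ a | z ≟ b
  ... | yes z≡a | _ = inj₁ z≡a
  ... | no _ | yes z≡b = inj₂ z≡b
  ... | no z≢a | no z≢b = ⊥-elim (no-middle z a≤z z≤b
        [ (λ min-z → z≢a (sym (min-z a a≤z))) , (λ max-z → z≢b (sym (max-z b z≤b))) ])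

  ≺-minimal : Minimal Q a
  ≺-minimal y y≤a with y ≟ a
  ... | yes y≡a = y≡a
  ... | no y≢a = ⊥-elim (no-middle a (refl′ (isPO Q) a) a≤b
        [ (λ min-a → y≢a (min-a y y≤a)) , (λ max-a → a≢b (sym (max-a b a≤b))) ])

  ≺-maximal : Maximal Q b
  ≺-maximal y b≤y with y ≟ b
  ... | yes y≡b = y≡b
  ... | no y≢b = ⊥-elim (no-middle b a≤b (refl′ (isPO Q) b)
        [ (λ min-b → a≢b (min-b a a≤b)) , (λ max-b → y≢b (max-b y b≤y)) ])

  module _ (conn : Connected (remove Q a b)) where

    lower-neighbour : ∃[ z ] (z ≤⟨ Q ⟩ b × z ≢ a × z ≢ b)
    lower-neighbour with Reach-leave (conn b a) (a≢b ∘ sym)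
    ... | z , z≢b , inj₁ (b≤z , _) = ⊥-elim (z≢b (≺-maximal z b≤z))
    ... | z , z≢b , inj₂ (z≤b , not-ab) = z , z≤b , (λ z≡a → not-ab (z≡a , refl)) , z≢b

    upper-neighbour : ∃[ w ] (a ≤⟨ Q ⟩ w × w ≢ a × w ≢ b)
    upper-neighbour with Reach-leave (conn a b) a≢b
    ... | w , w≢a , inj₁ (a≤w , not-ab) = w , a≤w , w≢a , (λ w≡b → not-ab (refl , w≡b))
    ... | w , w≢a , inj₂ (w≤a , _) = ⊥-elim (w≢a (≺-minimal w w≤a))

    lower-minimal : ∃[ m ] (m ≤⟨ Q ⟩ b × m ≢ a × Minimal Q m)
    lower-minimal with lower-neighbour
    ... | z , z≤b , z≢a , z≢b with minimal-below Q z
    ... | m , m≤z , min-m =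
      m , trans′ (isPO Q) m z b m≤z z≤b ,
      (λ { refl → [ z≢a , z≢b ] (≺-interval m≤z z≤b) }) , min-m

    upper-maximal : ∃[ M ] (a ≤⟨ Q ⟩ M × M ≢ b × Maximal Q M)
    upper-maximal with upper-neighbour
    ... | w , a≤w , w≢a , w≢b with maximal-above Q w
    ... | M , w≤M , max-M =
      M , trans′ (isPO Q) a w M a≤w w≤M ,
      (λ { refl → [ w≢a , w≢b ] (≺-interval a≤w w≤M) }) , max-M

module _ {k : ℕ} {P Q : Pos k} (P⊑Q : P ⊑ Q) where

  ⊑-minimal : ∀ {x} → Minimal Q x → Minimal P x
  ⊑-minimal min-x y y≤x = min-x y (P⊑Q y _ y≤x)

  ⊑-maximal : ∀ {x} → Maximal Q x → Maximal P x
  ⊑-maximal max-x y x≤y = max-x y (P⊑Q _ y x≤y)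

  ⊑-middle : ∀ {x} → Middle P x → Middle Q x
  ⊑-middle mid-x = mid-x ∘ [ inj₁ ∘ ⊑-minimal , inj₂ ∘ ⊑-maximal ]

  module _ (below : MinimaBelowMaxima P) where

    ≺-reflect : ∀ {a b} → a ≺⟨ Q ⟩ b → a ≺⟨ P ⟩ b
    ≺-reflect a≺b =
      (below _ _ (⊑-minimal (≺-minimal Q a≺b)) (⊑-maximal (≺-maximal Q a≺b)) ,
       proj₂ (proj₁ a≺b)) ,
      λ z a≤z z≤b → proj₂ a≺b z (P⊑Q _ _ a≤z) (P⊑Q _ _ z≤b) ∘ ⊑-middle

    detour : ∀ {a b} → a ≺⟨ Q ⟩ b → Connected (remove Q a b) → Reach (remove P a b) a b
    detour {a} {b} a≺b conn with lower-minimal Q a≺b conn | upper-maximal Q a≺b conn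
    ... | m , _ , m≢a , min-m | M , _ , M≢b , max-M =
      step (inj₁ (below a M min-a (⊑-maximal max-M) , M≢b ∘ proj₂))
        (step (inj₂ (below m M (⊑-minimal min-m) (⊑-maximal max-M) , m≢a ∘ proj₁))
          (step (inj₁ (below m b (⊑-minimal min-m) max-b , m≢a ∘ proj₁)) here))
      where
      min-a : Minimal P a
      min-a = ⊑-minimal (≺-minimal Q a≺b)

      max-b : Maximal P b
      max-b = ⊑-maximal (≺-maximal Q a≺b)

    FPP-extend : HasFPPGraph P → HasFPPGraph Q
    FPP-extend (conn , cut) =
      (λ x y → Reach-mono P⊑Q (conn x y)) ,
      λ a b a≺b conn-Q → cut a b (≺-reflect a≺b)
                             (remove-connected P conn (detour a≺b conn-Q))

module AddPair {k : ℕ} (P : Pos k) {l u : Fin k}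
  (min-l : Minimal P l) (max-u : Maximal P u) (l≰u : ¬ l ≤⟨ P ⟩ u) where

  private
    module P = IsPartialOrderOn (isPO P)

  added : BRel k
  added x y = rel P x y ∨ (isYes (x ≟ l) ∧ isYes (y ≟ u))

  _≤⁺_ : Fin k → Fin k → Set
  x ≤⁺ y = T (added x y)

  old : ∀ {x y} → x ≤⟨ P ⟩ y → x ≤⁺ y
  old {x} {y} = from (T-∨ {rel P x y}) ∘ inj₁

  new : l ≤⁺ u
  new = from (T-∨ {rel P l u})
             (inj₂ (from (T-∧ {isYes (l ≟ l)}) (fromWitness refl , fromWitness refl)))

  cases : ∀ {x y} → x ≤⁺ y → x ≤⟨ P ⟩ y ⊎ (x ≡ l × y ≡ u)
  cases {x} {y} x≤y with to (T-∨ {rel P x y}) x≤y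
  ... | inj₁ x≤ₚy = inj₁ x≤ₚy
  ... | inj₂ pair =
    let x≡l , y≡u = to (T-∧ {isYes (x ≟ l)}) pair in inj₂ (toWitness x≡l , toWitness y≡u)

  l≢u : l ≢ u
  l≢u l≡u = l≰u (subst (λ v → l ≤⟨ P ⟩ v) l≡u (P.refl′ l))

  u≰l : ¬ u ≤⟨ P ⟩ l
  u≰l u≤l = l≢u (sym (min-l u u≤l))

  Q : Pos k
  Q = record
    { rel  = added
    ; isPO = record { refl′ = λ x → old (P.refl′ x) ; antisym = antisym⁺ ; trans′ = trans⁺ }
    }
    where
    antisym⁺ : ∀ x y → x ≤⁺ y → y ≤⁺ x → x ≡ y
    antisym⁺ x y x≤y y≤x with cases x≤y | cases y≤x
    ... | inj₁ p | inj₁ q = P.antisym x y p q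
    ... | inj₁ p | inj₂ (refl , refl) = ⊥-elim (u≰l p)
    ... | inj₂ (refl , refl) | inj₁ q = ⊥-elim (u≰l q)
    ... | inj₂ (x≡l , _) | inj₂ (y≡l , _) = trans x≡l (sym y≡l)

    trans⁺ : ∀ x y z → x ≤⁺ y → y ≤⁺ z → x ≤⁺ z
    trans⁺ x y z x≤y y≤z with cases x≤y | cases y≤z
    ... | inj₁ p | inj₁ q = old (P.trans′ x y z p q)
    ... | inj₁ p | inj₂ (refl , refl) rewrite min-l x p = new
    ... | inj₂ (refl , refl) | inj₁ q rewrite max-u z q = new
    ... | inj₂ (refl , refl) | inj₂ (_ , refl) = new

  upperCover : UpperCover P Q
  upperCover = ((λ _ _ → old) , l , u , new , l≰u) , no-between
    where
    no-between : ∀ R → ¬ (P ⊏ R × R ⊏ Q)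
    no-between R ((P⊑R , x , y , x≤ᵣy , x≰ₚy) , (R⊑Q , x′ , y′ , x′≤y′ , x′≰ᵣy′))
      with cases (R⊑Q x y x≤ᵣy) | cases x′≤y′
    ... | inj₁ x≤ₚy | _ = x≰ₚy x≤ₚy
    ... | inj₂ _ | inj₁ x′≤ₚy′ = x′≰ᵣy′ (P⊑R x′ y′ x′≤ₚy′)
    ... | inj₂ (refl , refl) | inj₂ (refl , refl) = x′≰ᵣy′ x≤ᵣy

  l≺u : l ≺⟨ Q ⟩ u
  l≺u = (new , l≢u) , no-middle
    where
    minimal-l : Minimal Q l
    minimal-l y y≤l = [ min-l y , proj₁ ] (cases y≤l)

    maximal-u : Maximal Q u
    maximal-u y u≤y = [ max-u y , proj₂ ] (cases u≤y)

    no-middle : ∀ z → l ≤⟨ Q ⟩ z → z ≤⟨ Q ⟩ u → ¬ Middle Q z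
    no-middle z l≤z z≤u mid-z with cases l≤z | cases z≤u
    ... | inj₂ (_ , refl) | _ = mid-z (inj₂ maximal-u)
    ... | inj₁ _ | inj₂ (refl , _) = mid-z (inj₁ minimal-l)
    ... | inj₁ p | inj₁ q = l≰u (P.trans′ l z u p q)

  ¬FPP : Connected (≤rel P) → ¬ HasFPPGraph Q
  ¬FPP conn (_ , cut) = cut l u l≺u (λ x y → Reach-mono keep (conn x y))
    where
    keep : ∀ x y → x ≤⟨ P ⟩ y → remove Q l u x y
    keep x y x≤y = old x≤y , λ { (refl , refl) → l≰u x≤y }

corollary4 : (n : ℕ) (P : Pos (suc n)) → HasFPPGraph P →
    ((∀ (Q : Pos (suc n)) → UpperCover P Q → HasFPPGraph Q)
      ⇔ (∀ (l u : Fin (suc n)) → Minimal P l → Maximal P u → l ≤⟨ P ⟩ u))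
corollary4 n P fpp = mk⇔ covers⇒below below⇒covers
  where
  covers⇒below : (∀ Q → UpperCover P Q → HasFPPGraph Q) → MinimaBelowMaxima P
  covers⇒below covers l u min-l max-u with T? (rel P l u)
  ... | yes l≤u = l≤u
  ... | no l≰u = ⊥-elim (¬FPP (proj₁ fpp) (covers Q upperCover))
    where open AddPair P min-l max-u l≰u

  below⇒covers : MinimaBelowMaxima P → ∀ Q → UpperCover P Q → HasFPPGraph Q
  below⇒covers below Q ((P⊑Q , _) , _) = FPP-extend {P = P} {Q} P⊑Q below fpp
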